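{- Let $X$ be a graph and let $\mathcal{C}$ be a collection of cliques of $X$ such that every edge of $X$ lies in a unique clique of $\mathcal{C}$ and every vertex lies in at most $m$ cliques of $\mathcal{C}$. Then $\mu(X)\leq m^2$. If moreover $X$ is distance-regular of diameter $d\geq3$, then $\mu(X)\leq(m-1)^2$.
   Context: $\mu(X)$ denotes the maximum number of common neighbors of a pair of vertices at distance $2$ in $X$. A connected graph of diameter $d$ is distance-regular if for each $i$ there are constants $b_i,c_i$ such that for any vertices $v,w$ at distance $i$, $w$ has exactly $c_i$ neighbors at distance $i-1$ and $b_i$ at distance $i+1$ from $v$. -}

module Defs where

open import Data.Nat using (ℕ; zero; suc; _≤_; _<_; _*_; _∸_)
open import Data.Bool using (Bool; true; false)
open import Data.Fin using (Fin)
open import Data.Fin.Subset using (Subset; _∈_; ∣_∣)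
open import Data.Vec using (lookup; tabulate)
open import Data.Product using (Σ; _×_; ∃-syntax)
open import Relation.Binary.PropositionalEquality using (_≡_; _≢_)
open import Relation.Nullary using (¬_)
open import Function.Bundles using (_⇔_)

record Graph (n : ℕ) : Set where
  field
    Adj   : Fin n → Fin n → Bool
    sym   : ∀ u v → Adj u v ≡ Adj v u
    irrefl : ∀ u → Adj u u ≡ false
open Graph public

module _ {n : ℕ} (X : Graph n) where

  Adjacent : Fin n → Fin n → Set
  Adjacent u v = Adj X u v ≡ true

  Reach : ℕ → Fin n → Fin n → Set
  Reach zero    u v = u ≡ v
  Reach (suc k) u v = ∃[ x ] (Adjacent u x × Reach k x v)

  Dist : Fin n → Fin n → ℕ → Set
  Dist u v i = Reach i u v × (∀ j → j < i → ¬ Reach j u v)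

  HasCount : (Fin n → Set) → ℕ → Set
  HasCount P c = Σ (Subset n) λ S → (∀ x → (x ∈ S) ⇔ P x) × ∣ S ∣ ≡ c

  commonNbrs : Fin n → Fin n → Subset n
  commonNbrs u w = tabulate λ x → Data.Bool._∧_ (Adj X u x) (Adj X w x)

  μ≤ : ℕ → Set
  μ≤ B = ∀ u w → Dist u w 2 → ∣ commonNbrs u w ∣ ≤ B

  IsClique : Subset n → Set
  IsClique S = ∀ x y → x ∈ S → y ∈ S → x ≢ y → Adjacent x y

  EdgeUniquelyCovered : {k : ℕ} → (Fin k → Subset n) → Set
  EdgeUniquelyCovered {k} C =
    ∀ u v → Adjacent u v →
      ∃[ i ] ((u ∈ C i × v ∈ C i) × (∀ j → u ∈ C j → v ∈ C j → j ≡ i))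

  cliquesAt : {k : ℕ} → (Fin k → Subset n) → Fin n → Subset k
  cliquesAt C v = tabulate λ i → lookup (C i) v

  AtMostInCliques : {k : ℕ} → (Fin k → Subset n) → ℕ → Set
  AtMostInCliques C m = ∀ v → ∣ cliquesAt C v ∣ ≤ m

  Connected : Set
  Connected = ∀ u v → ∃[ i ] Dist u v i

  HasDiameter : ℕ → Set
  HasDiameter d = (∀ u v → ∃[ i ] (i ≤ d × Dist u v i)) × ∃[ u ] ∃[ v ] Dist u v d

  IsDistanceRegular : Set
  IsDistanceRegular =
    Connected ×
    Σ (ℕ → ℕ) λ b → Σ (ℕ → ℕ) λ c →
      ∀ i v w → Dist v w i →
        HasCount (λ x → Adjacent w x × Dist v x (i ∸ 1)) (c i)
        × HasCount (λ x → Adjacent w x × Dist v x (suc i)) (b i)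

-- A common neighbour x of two vertices u, w at distance 2 is determined by the pair
-- (clique of ux, clique of wx): two such neighbours with the same pair would share an
-- edge lying in both cliques, forcing the cliques to coincide and u, w to be adjacent.
-- The pair ranges over (cliques at u) × (cliques at w), giving m². In a distance-regular
-- graph of diameter at least 3 we have b₂ > 0, so w has a neighbour z at distance 3
-- from u; the clique of wz contains no neighbour of u, so it is never the second
-- component, and symmetrically for u. This removes one clique from each factor.
module Submission where

open import Defs hiding (sym)

open import Data.Nat using (ℕ; zero; suc; _+_; _*_; _∸_; _≤_; _<_; z≤n; s≤s)
open import Data.Nat.Properties
  using (≤-trans; n≮0; ≤-<-trans; <⇒≤pred; +-monoˡ-<; *-mono-≤; module ≤-Reasoning)
open import Data.Fin using (Fin; _≟_; _↑ˡ_; _↑ʳ_; combine)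
open import Data.Fin.Properties using (0≢1+n; suc-injective; combine-injective)
open import Data.Fin.Subset
  using (Subset; _∈_; ∣_∣; inside; outside; ⊥; _-_; Nonempty)
open import Data.Fin.Subset.Properties
  using (x∈p∧x≢y⇒x∈p-y; x∈p⇒∣p-x∣<∣p∣; nonempty?; Empty-unique; ∣⊥∣≡0)
open import Data.Bool using (true; _∧_)
open import Data.Vec using ([]; _∷_; _++_; here; there; lookup)
open import Data.Vec.Properties using ([]=⇒lookup; lookup⇒[]=; lookup∘tabulate)
open import Data.Product using (_×_; _,_; proj₁; proj₂; ∃-syntax)
open import Function.Bundles using (Equivalence)
open import Relation.Nullary using (¬_; yes; no; contradiction)
open import Relation.Binary.PropositionalEquality
  using (_≡_; _≢_; refl; sym; trans; cong; cong₂; subst)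

private
  variable
    n m l : ℕ

InjectiveOn : {A : Set} (p : Subset n) → (∀ {x} → x ∈ p → A) → Set
InjectiveOn p f = ∀ {x y} (x∈p : x ∈ p) (y∈p : y ∈ p) → f x∈p ≡ f y∈p → x ≡ y

injective⇒∣p∣≤∣q∣ : (p : Subset n) (q : Subset m) (f : ∀ {x} → x ∈ p → Fin m) →
  (∀ {x} (x∈p : x ∈ p) → f x∈p ∈ q) → InjectiveOn p f → ∣ p ∣ ≤ ∣ q ∣
injective⇒∣p∣≤∣q∣ [] q f f∈q inj = z≤n
injective⇒∣p∣≤∣q∣ (outside ∷ p) q f f∈q inj =
  injective⇒∣p∣≤∣q∣ p q (λ x∈p → f (there x∈p)) (λ x∈p → f∈q (there x∈p))
    (λ x∈p y∈p e → suc-injective (inj (there x∈p) (there y∈p) e))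
injective⇒∣p∣≤∣q∣ (inside ∷ p) q f f∈q inj = begin-strict
  ∣ p ∣          ≤⟨ injective⇒∣p∣≤∣q∣ p (q - f here) (λ x∈p → f (there x∈p)) f∈q-f₀
                      (λ x∈p y∈p e → suc-injective (inj (there x∈p) (there y∈p) e)) ⟩
  ∣ q - f here ∣ <⟨ x∈p⇒∣p-x∣<∣p∣ (f∈q here) ⟩
  ∣ q ∣          ∎
  where
  open ≤-Reasoning
  f∈q-f₀ : ∀ {x} (x∈p : x ∈ p) → f (there x∈p) ∈ q - f here
  f∈q-f₀ x∈p = x∈p∧x≢y⇒x∈p-y (f∈q (there x∈p)) (λ e → 0≢1+n (inj here (there x∈p) (sym e)))

∣p++q∣≡∣p∣+∣q∣ : (p : Subset m) (q : Subset n) → ∣ p ++ q ∣ ≡ ∣ p ∣ + ∣ q ∣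
∣p++q∣≡∣p∣+∣q∣ []            q = refl
∣p++q∣≡∣p∣+∣q∣ (outside ∷ p) q = ∣p++q∣≡∣p∣+∣q∣ p q
∣p++q∣≡∣p∣+∣q∣ (inside ∷ p)  q = cong suc (∣p++q∣≡∣p∣+∣q∣ p q)

x∈p⇒x↑ˡ∈p++q : ∀ {x} {p : Subset m} (q : Subset n) → x ∈ p → x ↑ˡ n ∈ p ++ q
x∈p⇒x↑ˡ∈p++q q here        = here
x∈p⇒x↑ˡ∈p++q q (there x∈p) = there (x∈p⇒x↑ˡ∈p++q q x∈p)

x∈q⇒m↑ʳx∈p++q : ∀ {x} (p : Subset m) {q : Subset n} → x ∈ q → m ↑ʳ x ∈ p ++ q
x∈q⇒m↑ʳx∈p++q []      x∈q = x∈q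
x∈q⇒m↑ʳx∈p++q (_ ∷ p) x∈q = there (x∈q⇒m↑ʳx∈p++q p x∈q)

-- The subset of Fin (m * n) corresponding to p × q under Data.Fin.combine.
_⊗_ : Subset m → Subset n → Subset (m * n)
[]            ⊗ q = []
(outside ∷ p) ⊗ q = ⊥ ++ p ⊗ q
(inside ∷ p)  ⊗ q = q ++ p ⊗ q

∣p⊗q∣≡∣p∣*∣q∣ : (p : Subset m) (q : Subset n) → ∣ p ⊗ q ∣ ≡ ∣ p ∣ * ∣ q ∣
∣p⊗q∣≡∣p∣*∣q∣ []            q = refl
∣p⊗q∣≡∣p∣*∣q∣ {n = n} (outside ∷ p) q =
  trans (∣p++q∣≡∣p∣+∣q∣ (⊥ {n = n}) (p ⊗ q)) (cong₂ _+_ (∣⊥∣≡0 n) (∣p⊗q∣≡∣p∣*∣q∣ p q))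
∣p⊗q∣≡∣p∣*∣q∣ (inside ∷ p)  q =
  trans (∣p++q∣≡∣p∣+∣q∣ q (p ⊗ q)) (cong (∣ q ∣ +_) (∣p⊗q∣≡∣p∣*∣q∣ p q))

combine-∈-⊗ : ∀ {i j} {p : Subset m} {q : Subset n} → i ∈ p → j ∈ q → combine i j ∈ p ⊗ q
combine-∈-⊗ {p = inside ∷ p}  {q} here        j∈q = x∈p⇒x↑ˡ∈p++q (p ⊗ q) j∈q
combine-∈-⊗ {n = n} {p = outside ∷ p} {q} (there i∈p) j∈q = x∈q⇒m↑ʳx∈p++q ⊥ (combine-∈-⊗ i∈p j∈q)
combine-∈-⊗ {p = inside ∷ p}  {q} (there i∈p) j∈q = x∈q⇒m↑ʳx∈p++q q (combine-∈-⊗ i∈p j∈q)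

injective⇒∣p∣≤∣q∣*∣r∣ : (p : Subset n) (q : Subset m) (r : Subset l)
  (f : ∀ {x} → x ∈ p → Fin m) (g : ∀ {x} → x ∈ p → Fin l) →
  (∀ {x} (x∈p : x ∈ p) → f x∈p ∈ q) → (∀ {x} (x∈p : x ∈ p) → g x∈p ∈ r) →
  (∀ {x y} (x∈p : x ∈ p) (y∈p : y ∈ p) → f x∈p ≡ f y∈p → g x∈p ≡ g y∈p → x ≡ y) →
  ∣ p ∣ ≤ ∣ q ∣ * ∣ r ∣
injective⇒∣p∣≤∣q∣*∣r∣ p q r f g f∈q g∈r inj =
  subst (∣ p ∣ ≤_) (∣p⊗q∣≡∣p∣*∣q∣ q r)
    (injective⇒∣p∣≤∣q∣ p (q ⊗ r) (λ x∈p → combine (f x∈p) (g x∈p))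
      (λ x∈p → combine-∈-⊗ (f∈q x∈p) (g∈r x∈p))
      (λ x∈p y∈p e → let f≡ , g≡ = combine-injective _ _ _ _ e in inj x∈p y∈p f≡ g≡))

∣p-x∣≤m∸1 : ∀ {x} {p : Subset n} → x ∈ p → ∣ p ∣ ≤ m → ∣ p - x ∣ ≤ m ∸ 1
∣p-x∣≤m∸1 x∈p ∣p∣≤m = <⇒≤pred (≤-trans (x∈p⇒∣p-x∣<∣p∣ x∈p) ∣p∣≤m)

0<∣p∣⇒Nonempty : (p : Subset n) → 0 < ∣ p ∣ → Nonempty p
0<∣p∣⇒Nonempty {n} p 0<∣p∣ with nonempty? p
... | yes nonempty = nonempty
... | no  empty    =
  contradiction (subst (0 <_) (trans (cong ∣_∣ (Empty-unique empty)) (∣⊥∣≡0 n)) 0<∣p∣) n≮0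

module _ (X : Graph n) where

  Adjacent-sym : ∀ {u v} → Adjacent X u v → Adjacent X v u
  Adjacent-sym {u} {v} u~v = trans (Graph.sym X v u) u~v

  Reach-++ : ∀ i {j u v w} → Reach X i u v → Reach X j v w → Reach X (i + j) u w
  Reach-++ zero    refl              v⇝w = v⇝w
  Reach-++ (suc i) (x , u~x , x⇝v) v⇝w = x , u~x , Reach-++ i x⇝v v⇝w

  Reach-∷ʳ : ∀ i {u v w} → Reach X i u v → Adjacent X v w → Reach X (suc i) u w
  Reach-∷ʳ zero    refl              v~w = _ , v~w , refl
  Reach-∷ʳ (suc i) (x , u~x , x⇝v) v~w = x , u~x , Reach-∷ʳ i x⇝v v~w

  Reach-sym : ∀ i {u v} → Reach X i u v → Reach X i v u
  Reach-sym zero    refl              = refl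
  Reach-sym (suc i) (x , u~x , x⇝v) = Reach-∷ʳ i (Reach-sym i x⇝v) (Adjacent-sym u~x)

  Dist-sym : ∀ {i u v} → Dist X u v i → Dist X v u i
  Dist-sym {i} (u⇝v , minimal) =
    Reach-sym i u⇝v , λ j j<i v⇝u → minimal j j<i (Reach-sym j v⇝u)

  Dist-onGeodesic : ∀ i j {a b q} → Dist X a b (i + j) →
    Reach X i a q → Reach X j q b → Dist X a q i
  Dist-onGeodesic i j (_ , minimal) a⇝q q⇝b =
    a⇝q , λ i′ i′<i a⇝′q → minimal (i′ + j) (+-monoˡ-< j i′<i) (Reach-++ i′ a⇝′q q⇝b)

  Dist-2⇒≢ : ∀ {u w} → Dist X u w 2 → u ≢ w
  Dist-2⇒≢ (_ , minimal) = minimal 0 (s≤s z≤n)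

  Dist-2⇒¬Adjacent : ∀ {u w} → Dist X u w 2 → ¬ Adjacent X u w
  Dist-2⇒¬Adjacent (_ , minimal) u~w = minimal 1 (s≤s (s≤s z≤n)) (_ , u~w , refl)

  Dist-3+⇒step : ∀ {e a b} → Dist X a b (3 + e) →
    ∃[ q ] ∃[ r ] (Dist X a q 2 × Adjacent X q r × Dist X a r 3)
  Dist-3+⇒step {e} a-b@((p , a~p , q , p~q , r , q~r , r⇝b) , _) =
    q , r , Dist-onGeodesic 2 (suc e) a-b (p , a~p , q , p~q , refl) (r , q~r , r⇝b)
          , q~r , Dist-onGeodesic 3 e a-b (p , a~p , q , p~q , r , q~r , refl) r⇝b

  HasCount⇒0< : ∀ {P c x} → HasCount X P c → P x → 0 < c
  HasCount⇒0< (S , S⇔P , ∣S∣≡c) Px =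
    subst (0 <_) ∣S∣≡c (≤-<-trans z≤n (x∈p⇒∣p-x∣<∣p∣ (Equivalence.from (S⇔P _) Px)))

  HasCount⇒witness : ∀ {P c} → HasCount X P c → 0 < c → ∃[ x ] P x
  HasCount⇒witness (S , S⇔P , ∣S∣≡c) 0<c with 0<∣p∣⇒Nonempty S (subst (0 <_) (sym ∣S∣≡c) 0<c)
  ... | x , x∈S = x , Equivalence.to (S⇔P x) x∈S

  far-neighbour : ∀ {d} → 3 ≤ d → IsDistanceRegular X → HasDiameter X d →
    ∀ {v w} → Dist X v w 2 → ∃[ z ] (Adjacent X w z × Dist X v z 3)
  far-neighbour (s≤s (s≤s (s≤s _))) (_ , b , _ , regular) (_ , a , _ , a-b) {v} {w} v-w =
    let q , r , a-q , q~r , a-r = Dist-3+⇒step a-b in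
    HasCount⇒witness (proj₂ (regular 2 v w v-w))
      (HasCount⇒0< (proj₂ (regular 2 a q a-q)) (q~r , a-r))

  ∈-commonNbrs⁻ : ∀ {u w x} → x ∈ commonNbrs X u w → Adjacent X u x × Adjacent X w x
  ∈-commonNbrs⁻ {u} {w} {x} x∈ =
    ∧-true (trans (sym (lookup∘tabulate (λ y → Adj X u y ∧ Adj X w y) x)) ([]=⇒lookup x∈))
    where
    ∧-true : ∀ {a b} → a ∧ b ≡ true → a ≡ true × b ≡ true
    ∧-true {true} {true} refl = refl , refl

∈-cliquesAt : ∀ {k} (X : Graph n) (C : Fin k → Subset n) {u i} → u ∈ C i → i ∈ cliquesAt X C u
∈-cliquesAt X C {u} {i} u∈Cᵢ =
  lookup⇒[]= i _ (trans (lookup∘tabulate (λ j → lookup (C j) u) i) ([]=⇒lookup u∈Cᵢ))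

module _ {k} (X : Graph n) (C : Fin k → Subset n)
         (cliques : ∀ i → IsClique X (C i)) (covered : EdgeUniquelyCovered X C) where

  cliqueOf : ∀ {u v} → Adjacent X u v → Fin k
  cliqueOf u~v = proj₁ (covered _ _ u~v)

  ∈-cliqueOfˡ : ∀ {u v} (u~v : Adjacent X u v) → u ∈ C (cliqueOf u~v)
  ∈-cliqueOfˡ u~v = proj₁ (proj₁ (proj₂ (covered _ _ u~v)))

  ∈-cliqueOfʳ : ∀ {u v} (u~v : Adjacent X u v) → v ∈ C (cliqueOf u~v)
  ∈-cliqueOfʳ u~v = proj₂ (proj₁ (proj₂ (covered _ _ u~v)))

  cliqueOf-unique : ∀ {u v j} (u~v : Adjacent X u v) → u ∈ C j → v ∈ C j → j ≡ cliqueOf u~v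
  cliqueOf-unique u~v = proj₂ (proj₂ (covered _ _ u~v)) _

  sharedEdge⇒sameClique : ∀ {x y i j} → x ≢ y →
    x ∈ C i → y ∈ C i → x ∈ C j → y ∈ C j → i ≡ j
  sharedEdge⇒sameClique x≢y x∈Cᵢ y∈Cᵢ x∈Cⱼ y∈Cⱼ =
    trans (cliqueOf-unique x~y x∈Cᵢ y∈Cᵢ) (sym (cliqueOf-unique x~y x∈Cⱼ y∈Cⱼ))
    where
    x~y = cliques _ _ _ x∈Cᵢ y∈Cᵢ x≢y

  cliques-meet-at-most-once : ∀ {u w i j x y} → u ≢ w → ¬ Adjacent X u w →
    u ∈ C i → w ∈ C j → x ∈ C i → x ∈ C j → y ∈ C i → y ∈ C j → x ≡ y
  cliques-meet-at-most-once {u} {w} {i} {j} {x} {y} u≢w u≁w u∈Cᵢ w∈Cⱼ x∈Cᵢ x∈Cⱼ y∈Cᵢ y∈Cⱼ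
    with x ≟ y
  ... | yes x≡y = x≡y
  ... | no  x≢y = contradiction (cliques i u w u∈Cᵢ w∈Cᵢ u≢w) u≁w
    where
    w∈Cᵢ : w ∈ C i
    w∈Cᵢ = subst (λ t → w ∈ C t) (sym (sharedEdge⇒sameClique x≢y x∈Cᵢ y∈Cᵢ x∈Cⱼ y∈Cⱼ)) w∈Cⱼ

  ∣commonNbrs∣≤∣p∣*∣q∣ : ∀ {u w} → Dist X u w 2 → (p q : Subset k) →
    (∀ {x} (u~x : Adjacent X u x) → Adjacent X w x → cliqueOf u~x ∈ p) →
    (∀ {x} (w~x : Adjacent X w x) → Adjacent X u x → cliqueOf w~x ∈ q) →
    ∣ commonNbrs X u w ∣ ≤ ∣ p ∣ * ∣ q ∣
  ∣commonNbrs∣≤∣p∣*∣q∣ {u} {w} u-w p q u-clique∈p w-clique∈q =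
    injective⇒∣p∣≤∣q∣*∣r∣ (commonNbrs X u w) p q
      (λ x∈ → cliqueOf (u~ x∈)) (λ x∈ → cliqueOf (w~ x∈))
      (λ x∈ → u-clique∈p (u~ x∈) (w~ x∈)) (λ x∈ → w-clique∈q (w~ x∈) (u~ x∈))
      (λ x∈ y∈ u-cliques≡ w-cliques≡ →
        cliques-meet-at-most-once (Dist-2⇒≢ X u-w) (Dist-2⇒¬Adjacent X u-w)
          (∈-cliqueOfˡ (u~ x∈)) (∈-cliqueOfˡ (w~ x∈))
          (∈-cliqueOfʳ (u~ x∈)) (∈-cliqueOfʳ (w~ x∈))
          (subst (λ t → _ ∈ C t) (sym u-cliques≡) (∈-cliqueOfʳ (u~ y∈)))
          (subst (λ t → _ ∈ C t) (sym w-cliques≡) (∈-cliqueOfʳ (w~ y∈))))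
    where
    u~ : ∀ {x} → x ∈ commonNbrs X u w → Adjacent X u x
    u~ x∈ = proj₁ (∈-commonNbrs⁻ X x∈)
    w~ : ∀ {x} → x ∈ commonNbrs X u w → Adjacent X w x
    w~ x∈ = proj₂ (∈-commonNbrs⁻ X x∈)

  μ≤m² : ∀ {m} → AtMostInCliques X C m → μ≤ X (m * m)
  μ≤m² atMost u w u-w =
    ≤-trans (∣commonNbrs∣≤∣p∣*∣q∣ u-w (cliquesAt X C u) (cliquesAt X C w)
               (λ u~x _ → ∈-cliquesAt X C (∈-cliqueOfˡ u~x))
               (λ w~x _ → ∈-cliquesAt X C (∈-cliqueOfˡ w~x)))
            (*-mono-≤ (atMost u) (atMost w))

  cliqueOf-far-≢ : ∀ {u w x z} (w~x : Adjacent X w x) → Adjacent X u x →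
    (w~z : Adjacent X w z) → Dist X u z 3 → cliqueOf w~x ≢ cliqueOf w~z
  cliqueOf-far-≢ {x = x} {z} w~x u~x w~z (_ , minimal) same with x ≟ z
  ... | yes refl = minimal 1 (s≤s (s≤s z≤n)) (_ , u~x , refl)
  ... | no  x≢z  = minimal 2 (s≤s (s≤s (s≤s z≤n))) (_ , u~x , _ , x~z , refl)
    where
    x~z : Adjacent X x z
    x~z = cliques _ _ _ (subst (λ t → x ∈ C t) same (∈-cliqueOfʳ w~x)) (∈-cliqueOfʳ w~z) x≢z

  μ≤[m∸1]² : ∀ {m} → AtMostInCliques X C m →
    (∀ {v w} → Dist X v w 2 → ∃[ z ] (Adjacent X w z × Dist X v z 3)) →
    μ≤ X ((m ∸ 1) * (m ∸ 1))
  μ≤[m∸1]² atMost far u w u-w =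
    let z , w~z , u-z = far u-w
        z′ , u~z′ , w-z′ = far (Dist-sym X u-w)
    in ≤-trans
         (∣commonNbrs∣≤∣p∣*∣q∣ u-w (cliquesAt X C u - cliqueOf u~z′) (cliquesAt X C w - cliqueOf w~z)
           (λ u~x w~x → x∈p∧x≢y⇒x∈p-y (∈-cliquesAt X C (∈-cliqueOfˡ u~x)) (cliqueOf-far-≢ u~x w~x u~z′ w-z′))
           (λ w~x u~x → x∈p∧x≢y⇒x∈p-y (∈-cliquesAt X C (∈-cliqueOfˡ w~x)) (cliqueOf-far-≢ w~x u~x w~z u-z)))
         (*-mono-≤ (∣p-x∣≤m∸1 (∈-cliquesAt X C (∈-cliqueOfˡ u~z′)) (atMost u))
                   (∣p-x∣≤m∸1 (∈-cliquesAt X C (∈-cliqueOfˡ w~z)) (atMost w)))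

lemma3p30 : ∀ {n k : ℕ} (X : Graph n) (C : Fin k → Subset n) (m : ℕ) →
    (∀ i → IsClique X (C i)) →
    EdgeUniquelyCovered X C →
    AtMostInCliques X C m →
    μ≤ X (m * m)
      × (∀ d → 3 ≤ d → IsDistanceRegular X → HasDiameter X d →
           μ≤ X ((m ∸ 1) * (m ∸ 1)))
lemma3p30 X C m cliques covered atMost =
  μ≤m² X C cliques covered atMost ,
  λ d 3≤d regular diameter →
    μ≤[m∸1]² X C cliques covered atMost (far-neighbour X 3≤d regular diameter)
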